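{- For every fixed integer $k\ge3$ there exists $\gamma_k>0$ such that in any $2$-coloring of the edges of $K_n$ there are at least $(1-o(1))\gamma_k n^2$ pairwise edge-disjoint monochromatic copies of $K_k$, all of the same color, where $o(1)\to0$ as $n\to\infty$. -}

module Defs where

open import Data.Nat using (ℕ; _*_)
open import Data.Fin using (Fin)
open import Data.Bool using (Bool)
open import Data.Empty using (⊥)
open import Relation.Binary.PropositionalEquality using (_≡_; _≢_)
open import Function.Definitions using (Injective)

-- A 2-colouring of the edges of K_n: colour of edge {i,j} is c i j
-- (values on the diagonal are irrelevant); must be symmetric.
Colouring : ℕ → Set
Colouring n = Fin n → Fin n → Bool

SymmetricColouring : ∀ {n} → Colouring n → Set
SymmetricColouring c = ∀ i j → c i j ≡ c j i

IsCopy : ∀ {k n} → (Fin k → Fin n) → Set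
IsCopy f = Injective _≡_ _≡_ f

Monochromatic : ∀ {k n} → Colouring n → Bool → (Fin k → Fin n) → Set
Monochromatic c b f = ∀ a a' → a ≢ a' → c (f a) (f a') ≡ b

EdgeDisjoint : ∀ {k n} → (Fin k → Fin n) → (Fin k → Fin n) → Set
EdgeDisjoint f g = ∀ a a' d d' → a ≢ a' → f a ≡ g d → f a' ≡ g d' → ⊥

MonoPackingOfSize : ∀ {n} → (k : ℕ) → Colouring n → Bool → ℕ → Set
MonoPackingOfSize {n} k c b t =
  Σ' (Fin t → Fin k → Fin n) λ F →
    (∀ s → IsCopy (F s)) ×' (∀ s → Monochromatic c b (F s)) ×'
    (∀ s s' → s ≢ s' → EdgeDisjoint (F s) (F s'))
  where
  open import Data.Product using () renaming (Σ to Σ'; _×_ to _×'_)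

module Submission where

-- Place an R × sR grid in K_n, with R = 2^(2k) + 1 and s = ⌊n / R²⌋, and take as lines the s² graphs
-- x ↦ a·x + b (a, b < s) of affine maps over the R columns.  Two distinct lines share at most one point,
-- so cliques on distinct lines are edge-disjoint.  By Ramsey's theorem each line carries a monochromatic
-- K_k; the majority colour occurs on at least s²/2 lines, which gives at least n² / (8R⁴) edge-disjoint
-- monochromatic copies of K_k of one colour as soon as n ≥ R², with no error term.

open import Defs
open import Data.Bool using (Bool; true; false; _≟_)
open import Data.Empty using (⊥-elim)
open import Data.Fin using (Fin; zero; suc; toℕ; fromℕ<; inject≤; combine; remQuot; quotient; remainder)
open import Data.Fin.Properties using (toℕ<n; toℕ-injective; toℕ-fromℕ<; inject≤-injective; combine-injective; combine-remQuot)
open import Data.List using (List; []; _∷_; length; filter; lookup; allFin)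
open import Data.List.Membership.Propositional using (_∈_)
open import Data.List.Membership.Propositional.Properties using (∈-lookup; ∈-filter⁻)
open import Data.List.Properties using (length-tabulate)
open import Data.List.Relation.Binary.Subset.Propositional using (_⊆_)
open import Data.List.Relation.Binary.Subset.Propositional.Properties using (filter-⊆; ∷⁺ʳ)
open import Data.List.Relation.Unary.All as All using (All)
import Data.List.Relation.Unary.All.Properties as All
open import Data.List.Relation.Unary.AllPairs using (_∷_)
open import Data.List.Relation.Unary.Any using (here; there)
open import Data.List.Relation.Unary.Unique.Propositional using (Unique)
import Data.List.Relation.Unary.Unique.Propositional.Properties as Unique
open import Data.Nat using (ℕ; zero; suc; _+_; _*_; _^_; _∸_; _≤_; _<_; s≤s; z≤n; NonZero; >-nonZero)
open import Data.Nat.DivMod using (_/_; _%_; m/n*n≤m; m≡m%n+[m/n]*n; m%n<n; m≥n⇒m/n>0)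
open import Data.Nat.Properties
  using ( ≤-trans; ≤-reflexive; ≤-total; <⇒≤; <⇒≱; <-cmp; n≤1+n; m<1+n⇒m≤n; m≤n⇒∃[o]m+o≡n; m≤n*m; m∸n≤m; m^n>0
        ; +-comm; +-suc; +-identityʳ; +-cancelˡ-≡; +-monoˡ-≤; +-monoʳ-<
        ; *-comm; *-suc; *-identityʳ; *-cancelʳ-≡; *-cancelˡ-<; *-mono-≤; *-monoˡ-≤; *-monoʳ-≤
        ; module ≤-Reasoning )
open import Data.Nat.Tactic.RingSolver using (solve-∀)
open import Data.Product using (Σ; ∃; _×_; _,_; proj₁; proj₂; uncurry)
open import Data.Sum using (_⊎_; inj₁; inj₂)
open import Function using (_∘_; id)
open import Function.Definitions using (Injective)
open import Relation.Binary.Definitions using (tri<; tri≈; tri>)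
open import Relation.Binary.PropositionalEquality
  using (_≡_; _≢_; refl; sym; trans; cong; cong₂; subst; module ≡-Reasoning)

m≤n⇒m+n≤2*n : ∀ {m n} → m ≤ n → m + n ≤ 2 * n
m≤n⇒m+n≤2*n {m} {n} m≤n = begin
  m + n  ≤⟨ +-monoˡ-≤ n m≤n ⟩
  n + n  ≡⟨ cong (n +_) (+-identityʳ n) ⟨
  2 * n  ∎
  where open ≤-Reasoning

2*m≤1+2*n⇒m≤n : ∀ {m n} → 2 * m ≤ suc (2 * n) → m ≤ n
2*m≤1+2*n⇒m≤n {m} {n} h = m<1+n⇒m≤n (*-cancelˡ-< 2 m (suc n) (≤-trans (s≤s h) (≤-reflexive (sym (*-suc 2 n)))))

lookup-injective : ∀ {A : Set} {xs : List A} → Unique xs → Injective _≡_ _≡_ (lookup xs)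
lookup-injective {xs = _ ∷ _} _             {zero}  {zero}  _  = refl
lookup-injective {xs = _ ∷ _} (x∉xs ∷ _)    {zero}  {suc j} eq = ⊥-elim (All.lookup x∉xs (∈-lookup j) eq)
lookup-injective {xs = _ ∷ _} (x∉xs ∷ _)    {suc i} {zero}  eq = ⊥-elim (All.lookup x∉xs (∈-lookup i) (sym eq))
lookup-injective {xs = _ ∷ _} (_ ∷ unique)  {suc i} {suc j} eq = cong suc (lookup-injective unique eq)

module _ {A : Set} (f : A → Bool) where

  colourClass : Bool → List A → List A
  colourClass b = filter (λ x → f x ≟ b)

  length-colourClasses : ∀ xs → length (colourClass true xs) + length (colourClass false xs) ≡ length xs
  length-colourClasses [] = refl
  length-colourClasses (x ∷ xs) with f x
  ... | true  = cong suc (length-colourClasses xs)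
  ... | false = trans (+-suc _ _) (cong suc (length-colourClasses xs))

  majority-colourClass : ∀ xs → Σ Bool λ b → length xs ≤ 2 * length (colourClass b xs)
  majority-colourClass xs with ≤-total (length (colourClass true xs)) (length (colourClass false xs))
  ... | inj₁ T≤F = false , subst (_≤ 2 * length (colourClass false xs)) (length-colourClasses xs) (m≤n⇒m+n≤2*n T≤F)
  ... | inj₂ F≤T = true , subst (_≤ 2 * length (colourClass true xs))
                                (trans (+-comm (length (colourClass false xs)) _) (length-colourClasses xs))
                                (m≤n⇒m+n≤2*n F≤T)

majority-colour-injection : ∀ {L} (β : Fin L → Bool) → Σ Bool λ b → Σ ℕ λ t →
                            Σ (Fin t → Fin L) λ g → Injective _≡_ _≡_ g × (∀ i → β (g i) ≡ b) × L ≤ 2 * t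
majority-colour-injection {L} β with majority-colourClass β (allFin L)
... | b , maj = b , length C , lookup C , lookup-injective (Unique.filter⁺ _ (Unique.allFin⁺ L)) ,
                (λ i → proj₂ (∈-filter⁻ (λ l → β l ≟ b) {xs = allFin L} (∈-lookup i))) ,
                subst (_≤ 2 * length C) (length-tabulate id) maj
  where
  C : List (Fin L)
  C = colourClass β b (allFin L)

module Ramsey {R : ℕ} (c : Colouring R) where

  record MonoCliqueIn (b : Bool) (a : ℕ) (S : List (Fin R)) : Set where
    field
      vertex   : Fin a → Fin R
      isCopy   : IsCopy vertex
      mono     : Monochromatic c b vertex
      vertex∈S : ∀ i → vertex i ∈ S

  open MonoCliqueIn

  emptyClique : ∀ {b S} → MonoCliqueIn b 0 S
  emptyClique .vertex ()
  emptyClique .isCopy {()}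
  emptyClique .mono ()
  emptyClique .vertex∈S ()

  weaken : ∀ {b a T S} → T ⊆ S → MonoCliqueIn b a T → MonoCliqueIn b a S
  weaken T⊆S K = record { vertex = vertex K ; isCopy = isCopy K ; mono = mono K ; vertex∈S = T⊆S ∘ vertex∈S K }

  module _ (c-sym : SymmetricColouring c) where

    extend : ∀ {b a v T} → All (v ≢_) T → (∀ {w} → w ∈ T → c v w ≡ b) →
             MonoCliqueIn b a T → MonoCliqueIn b (suc a) (v ∷ T)
    extend {b} {a} {v} {T} v∉T vT≡b K = record { vertex = vertex′ ; isCopy = isCopy′ ; mono = mono′ ; vertex∈S = vertex′∈ }
      where
      vertex′ : Fin (suc a) → Fin R
      vertex′ zero    = v
      vertex′ (suc i) = vertex K i

      v≢vertex : ∀ i → v ≢ vertex K i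
      v≢vertex i = All.lookup v∉T (vertex∈S K i)

      isCopy′ : IsCopy vertex′
      isCopy′ {zero}  {zero}  _  = refl
      isCopy′ {zero}  {suc j} eq = ⊥-elim (v≢vertex j eq)
      isCopy′ {suc i} {zero}  eq = ⊥-elim (v≢vertex i (sym eq))
      isCopy′ {suc i} {suc j} eq = cong suc (isCopy K eq)

      mono′ : Monochromatic c b vertex′
      mono′ zero    zero    i≢j = ⊥-elim (i≢j refl)
      mono′ zero    (suc j) _   = vT≡b (vertex∈S K j)
      mono′ (suc i) zero    _   = trans (c-sym (vertex K i) v) (vT≡b (vertex∈S K i))
      mono′ (suc i) (suc j) i≢j = mono K i j (i≢j ∘ cong suc)

      vertex′∈ : ∀ i → vertex′ i ∈ v ∷ T
      vertex′∈ zero    = here refl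
      vertex′∈ (suc i) = there (vertex∈S K i)

    -- Erdős–Szekeres: the neighbourhood of v in the majority colour has at least 2^(a+b+1) vertices.
    ramsey : ∀ a b S → Unique S → 2 ^ (a + b) ≤ length S → MonoCliqueIn true a S ⊎ MonoCliqueIn false b S
    ramsey zero    b       S          _                        _ = inj₁ emptyClique
    ramsey (suc a) zero    S          _                        _ = inj₂ emptyClique
    ramsey (suc a) (suc b) []         _                        h = ⊥-elim (<⇒≱ (m^n>0 2 (suc a + suc b)) h)
    ramsey (suc a) (suc b) (v ∷ rest) (v∉rest ∷ rest-unique) h = step (majority-colourClass (c v) rest)
      where
      N : Bool → List (Fin R)
      N β = colourClass (c v) β rest

      N-unique : ∀ β → Unique (N β)
      N-unique β = Unique.filter⁺ _ rest-unique

      N⊆rest : ∀ β → N β ⊆ rest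
      N⊆rest β = filter-⊆ _ rest

      v∉N : ∀ β → All (v ≢_) (N β)
      v∉N β = All.filter⁺ _ v∉rest

      vN≡ : ∀ β {w} → w ∈ N β → c v w ≡ β
      vN≡ β = proj₂ ∘ ∈-filter⁻ (λ w → c v w ≟ β) {xs = rest}

      N-large : ∀ β → length rest ≤ 2 * length (N β) → 2 ^ suc (a + b) ≤ length (N β)
      N-large β maj =
        2*m≤1+2*n⇒m≤n (≤-trans (subst (_≤ suc (length rest)) (cong (2 ^_) (cong suc (+-suc a b))) h) (s≤s maj))

      step : Σ Bool (λ β → length rest ≤ 2 * length (N β)) →
             MonoCliqueIn true (suc a) (v ∷ rest) ⊎ MonoCliqueIn false (suc b) (v ∷ rest)
      step (true , maj) with ramsey a (suc b) (N true) (N-unique true)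
                                    (subst (λ e → 2 ^ e ≤ length (N true)) (sym (+-suc a b)) (N-large true maj))
      ... | inj₁ K = inj₁ (weaken (∷⁺ʳ v (N⊆rest true)) (extend (v∉N true) (vN≡ true) K))
      ... | inj₂ K = inj₂ (weaken (there ∘ N⊆rest true) K)
      step (false , maj) with ramsey (suc a) b (N false) (N-unique false) (N-large false maj)
      ... | inj₁ K = inj₁ (weaken (there ∘ N⊆rest false) K)
      ... | inj₂ K = inj₂ (weaken (∷⁺ʳ v (N⊆rest false)) (extend (v∉N false) (vN≡ false) K))

    ramsey-diagonal : ∀ k → 2 ^ (k + k) ≤ R → Σ Bool λ b → MonoCliqueIn b k (allFin R)
    ramsey-diagonal k h with ramsey k k (allFin R) (Unique.allFin⁺ R) (subst (2 ^ (k + k) ≤_) (sym (length-tabulate id)) h)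
    ... | inj₁ K = true , K
    ... | inj₂ K = false , K

affine-shift : ∀ A B x e → A * (suc x + e) + B ≡ (A * x + B) + A * suc e
affine-shift = solve-∀

affine-agree-twice-< : ∀ {A B A′ B′ x y} → x < y → A * x + B ≡ A′ * x + B′ → A * y + B ≡ A′ * y + B′ → A ≡ A′ × B ≡ B′
affine-agree-twice-< {A} {B} {A′} {B′} {x} x<y at-x at-y with m≤n⇒∃[o]m+o≡n x<y
... | e , refl = A≡A′ , +-cancelˡ-≡ (A′ * x) B B′ (subst (λ a → a * x + B ≡ A′ * x + B′) A≡A′ at-x)
  where
  A≡A′ : A ≡ A′
  A≡A′ = *-cancelʳ-≡ A A′ (suc e) (+-cancelˡ-≡ (A * x + B) _ _ (begin
    (A * x + B) + A * suc e     ≡⟨ affine-shift A B x e ⟨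
    A * (suc x + e) + B         ≡⟨ at-y ⟩
    A′ * (suc x + e) + B′       ≡⟨ affine-shift A′ B′ x e ⟩
    (A′ * x + B′) + A′ * suc e  ≡⟨ cong (_+ A′ * suc e) at-x ⟨
    (A * x + B) + A′ * suc e    ∎))
    where open ≡-Reasoning

affine-agree-twice : ∀ {A B A′ B′ x y} → x ≢ y → A * x + B ≡ A′ * x + B′ → A * y + B ≡ A′ * y + B′ → A ≡ A′ × B ≡ B′
affine-agree-twice {x = x} {y} x≢y at-x at-y with <-cmp x y
... | tri< x<y _ _ = affine-agree-twice-< x<y at-x at-y
... | tri≈ _ x≡y _ = ⊥-elim (x≢y x≡y)
... | tri> _ _ y<x = affine-agree-twice-< y<x at-y at-x

-- The grid is Fin R × Fin (s * R), embedded in Fin n through combine; a line l ∈ Fin (s * s) encodes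
-- the pair (slope, intercept) via remQuot, and its points are (x , slope·x + intercept).
module Grid {n : ℕ} (s R : ℕ) (fits : R * (s * R) ≤ n) where

  Line : Set
  Line = Fin (s * s)

  slope intercept : Line → ℕ
  slope l     = toℕ (quotient {s} s l)
  intercept l = toℕ (remainder {s} s l)

  height : Line → Fin R → ℕ
  height l x = slope l * toℕ x + intercept l

  height<sR : ∀ l x → height l x < s * R
  height<sR l x = begin-strict
    slope l * toℕ x + intercept l  <⟨ +-monoʳ-< (slope l * toℕ x) (toℕ<n (remainder {s} s l)) ⟩
    slope l * toℕ x + s            ≤⟨ +-monoˡ-≤ s (*-monoˡ-≤ (toℕ x) (<⇒≤ (toℕ<n (quotient {s} s l)))) ⟩
    s * toℕ x + s                  ≡⟨ trans (+-comm (s * toℕ x) s) (sym (*-suc s (toℕ x))) ⟩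
    s * suc (toℕ x)                ≤⟨ *-monoʳ-≤ s (toℕ<n x) ⟩
    s * R                          ∎
    where open ≤-Reasoning

  point : Line → Fin R → Fin n
  point l x = inject≤ (combine x (fromℕ< (height<sR l x))) fits

  point-coordinates : ∀ {l l′ x y} → point l x ≡ point l′ y → x ≡ y × height l x ≡ height l′ y
  point-coordinates {l} {l′} {x} {y} eq with combine-injective x _ y _ (inject≤-injective fits fits _ _ eq)
  ... | x≡y , h≡h = x≡y , trans (sym (toℕ-fromℕ< (height<sR l x))) (trans (cong toℕ h≡h) (toℕ-fromℕ< (height<sR l′ y)))

  line-ext : ∀ {l l′} → slope l ≡ slope l′ → intercept l ≡ intercept l′ → l ≡ l′
  line-ext {l} {l′} slope≡ intercept≡ = begin
    l                                   ≡⟨ combine-remQuot {s} s l ⟨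
    uncurry combine (remQuot {s} s l)   ≡⟨ cong (uncurry combine) (cong₂ _,_ (toℕ-injective slope≡) (toℕ-injective intercept≡)) ⟩
    uncurry combine (remQuot {s} s l′)  ≡⟨ combine-remQuot {s} s l′ ⟩
    l′                                  ∎
    where open ≡-Reasoning

  point-injective : ∀ l → Injective _≡_ _≡_ (point l)
  point-injective l = proj₁ ∘ point-coordinates

  lines-meet-once : ∀ {l l′ x x′ y y′} → x ≢ x′ → point l x ≡ point l′ y → point l x′ ≡ point l′ y′ → l ≡ l′
  lines-meet-once x≢x′ at-x at-x′ with point-coordinates at-x | point-coordinates at-x′
  ... | refl , h | refl , h′ = uncurry line-ext (affine-agree-twice (x≢x′ ∘ toℕ-injective) h h′)

module LinearSpace {n R L : ℕ} (point : Fin L → Fin R → Fin n)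
         (point-injective : ∀ l → Injective _≡_ _≡_ (point l))
         (lines-meet-once : ∀ {l l′ x x′ y y′} → x ≢ x′ → point l x ≡ point l′ y → point l x′ ≡ point l′ y′ → l ≡ l′)
         where

  onLine : Colouring n → Fin L → Colouring R
  onLine c l x y = c (point l x) (point l y)

  packing-from-lines : ∀ {k t} (c : Colouring n) (b : Bool) (line : Fin t → Fin L) → Injective _≡_ _≡_ line →
                       (copy : Fin t → Fin k → Fin R) → (∀ i → IsCopy (copy i)) →
                       (∀ i → Monochromatic (onLine c (line i)) b (copy i)) → MonoPackingOfSize k c b t
  packing-from-lines {k} {t} c b line line-injective copy copy-isCopy copy-mono = F , isCopy , copy-mono , disjoint
    where
    F : Fin t → Fin k → Fin n
    F i = point (line i) ∘ copy i

    isCopy : ∀ i → IsCopy (F i)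
    isCopy i = copy-isCopy i ∘ point-injective (line i)

    disjoint : ∀ i j → i ≢ j → EdgeDisjoint (F i) (F j)
    disjoint i j i≢j a a′ _ _ a≢a′ at-a at-a′ =
      i≢j (line-injective (lines-meet-once (a≢a′ ∘ copy-isCopy i) at-a at-a′))

grid-size : ∀ R s → R * (s * R) ≡ s * (R * R)
grid-size = solve-∀

m≤2[m/n*n] : ∀ {m n} .{{_ : NonZero n}} → n ≤ m → m ≤ 2 * (m / n * n)
m≤2[m/n*n] {m} {n} n≤m = begin
  m                      ≡⟨ m≡m%n+[m/n]*n m n ⟩
  m % n + m / n * n      ≤⟨ +-monoˡ-≤ (m / n * n) (<⇒≤ (m%n<n m n)) ⟩
  n + m / n * n          ≤⟨ +-monoˡ-≤ (m / n * n) (m≤n*m n (m / n) {{>-nonZero (m≥n⇒m/n>0 n≤m)}}) ⟩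
  m / n * n + m / n * n  ≡⟨ cong (m / n * n +_) (+-identityʳ (m / n * n)) ⟨
  2 * (m / n * n)        ∎
  where open ≤-Reasoning

square-bound : ∀ {n s d t} → n ≤ 2 * (s * d) → s * s ≤ 2 * t → n * n ≤ t * (8 * (d * d))
square-bound {n} {s} {d} {t} n≤2sd s*s≤2t = begin
  n * n                        ≤⟨ *-mono-≤ n≤2sd n≤2sd ⟩
  2 * (s * d) * (2 * (s * d))  ≡⟨ regroupˡ s d ⟩
  4 * (d * d) * (s * s)        ≤⟨ *-monoʳ-≤ (4 * (d * d)) s*s≤2t ⟩
  4 * (d * d) * (2 * t)        ≡⟨ regroupʳ t d ⟩
  t * (8 * (d * d))            ∎
  where
  open ≤-Reasoning
  regroupˡ : ∀ s d → 2 * (s * d) * (2 * (s * d)) ≡ 4 * (d * d) * (s * s)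
  regroupˡ = solve-∀
  regroupʳ : ∀ t d → 4 * (d * d) * (2 * t) ≡ t * (8 * (d * d))
  regroupʳ = solve-∀

drop-error-term : ∀ m {x y} → x ≤ y → (m ∸ 1) * 1 * x ≤ y * m
drop-error-term m {x} {y} x≤y = begin
  (m ∸ 1) * 1 * x  ≤⟨ *-monoˡ-≤ x (≤-trans (≤-reflexive (*-identityʳ (m ∸ 1))) (m∸n≤m m 1)) ⟩
  m * x            ≤⟨ *-monoʳ-≤ m x≤y ⟩
  m * y            ≡⟨ *-comm m y ⟩
  y * m            ∎
  where open ≤-Reasoning

module Construction (k : ℕ) where

  open Ramsey using (MonoCliqueIn; ramsey-diagonal)
  open MonoCliqueIn

  R : ℕ
  R = suc (2 ^ (k + k))

  D : ℕ
  D = R * R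

  module _ {n : ℕ} (c : Colouring n) (c-sym : SymmetricColouring c) where

    s : ℕ
    s = n / D

    open Grid s R (≤-trans (≤-reflexive (grid-size R s)) (m/n*n≤m n D))
    -- y and y′ are not recoverable from point l′ y by unification, hence the explicit η-expansion.
    open LinearSpace point point-injective (λ {_ _ _ _ y y′} → lines-meet-once {y = y} {y′ = y′})

    lineClique : (l : Line) → Σ Bool λ β → MonoCliqueIn (onLine c l) β k (allFin R)
    lineClique l = ramsey-diagonal (onLine c l) (λ x y → c-sym (point l x) (point l y)) k (n≤1+n _)

    dense-packing : D ≤ n → Σ Bool λ b → Σ ℕ λ t → MonoPackingOfSize k c b t × n * n ≤ t * (8 * (D * D))
    dense-packing D≤n =
      let b , t , line , line-injective , line-colour , s*s≤2t = majority-colour-injection (proj₁ ∘ lineClique)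
          clique i = proj₂ (lineClique (line i))
      in  b , t ,
          packing-from-lines c b line line-injective (λ i → vertex (clique i)) (λ i → isCopy (clique i))
            (λ i a a′ a≢a′ → trans (mono (clique i) a a′ a≢a′) (line-colour i)) ,
          square-bound {n} {s} {D} {t} (m≤2[m/n*n] D≤n) s*s≤2t

lemma4p4 : (k : ℕ) → 3 ≤ k → Σ ℕ λ p → Σ ℕ λ q → 0 < p × 0 < q × ((m : ℕ) → 0 < m → ∃ λ N → (n : ℕ) → N ≤ n → (c : Colouring n) → SymmetricColouring c → Σ Bool λ b → Σ ℕ λ t → MonoPackingOfSize k c b t × (m ∸ 1) * p * (n * n) ≤ t * q * m)
lemma4p4 k _ = 1 , 8 * (D * D) , s≤s z≤n , s≤s z≤n , λ m _ → D , λ n D≤n c c-sym →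
  let b , t , packing , n*n≤ = dense-packing c c-sym D≤n
  in  b , t , packing , drop-error-term m n*n≤
  where open Construction k
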